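{- Let $n\ge 3$ and let $K_{1,n}^\sigma=(K_{1,n},\sigma)$ be a signed star that is non-homogeneous (i.e. it has at least one positive and at least one negative edge). Then $\dim(K_{1,n}^\sigma)=n-2$.
   Context: A signed graph is $(G,\sigma)$ with $\sigma:E(G)\to\{+1,-1\}$. In a signed tree, the sign $\sigma(uv)$ of the unique $u$–$v$ path is the product of its edge signs, and the signed distance is $d_\Sigma(u,v)=\sigma(uv)d(u,v)$, $d$ the graph distance. For an ordered vertex set $W=(w_1,\dots,w_k)$, $r(v|W)=(d_\Sigma(v,w_1),\dots,d_\Sigma(v,w_k))$; $W$ is resolving if distinct vertices have distinct representations; $\dim$ is the minimum cardinality of a resolving set. -}

module Defs where

open import Data.Nat using (ℕ; zero; suc; _≤_)
open import Data.Fin using (Fin; zero; suc; _≟_)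
open import Data.Integer using (ℤ; _◃_)
open import Data.Sign using (Sign; +; -) renaming (_*_ to _*ˢ_)
open import Data.Vec using (Vec; map; lookup)
open import Data.Product using (Σ; ∃; _×_)
open import Relation.Binary.PropositionalEquality using (_≡_)
open import Relation.Nullary using (yes; no)
open import Function.Definitions using (Injective)

-- The star K_{1,n}: vertex set Fin (suc n); vertex 'zero' is the centre,
-- vertex 'suc i' is the i-th leaf; edge (centre, leaf i) for each i : Fin n.
StarVertex : ℕ → Set
StarVertex n = Fin (suc n)

StarSignature : ℕ → Set
StarSignature n = Fin n → Sign

-- Sign of the unique path between two vertices of the star (product of the
-- edge signs along the path; the empty path has sign +).
pathSign : ∀ {n} → StarSignature n → StarVertex n → StarVertex n → Sign
pathSign σ zero    zero    = +
pathSign σ zero    (suc j) = σ j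
pathSign σ (suc i) zero    = σ i
pathSign σ (suc i) (suc j) with i ≟ j
... | yes _ = +
... | no  _ = σ i *ˢ σ j

dist : ∀ {n} → StarVertex n → StarVertex n → ℕ
dist zero    zero    = 0
dist zero    (suc j) = 1
dist (suc i) zero    = 1
dist (suc i) (suc j) with i ≟ j
... | yes _ = 0
... | no  _ = 2

signedDist : ∀ {n} → StarSignature n → StarVertex n → StarVertex n → ℤ
signedDist σ u v = pathSign σ u v ◃ dist u v

rep : ∀ {n k} → StarSignature n → Vec (StarVertex n) k → StarVertex n → Vec ℤ k
rep σ W v = map (signedDist σ v) W

IsVertexSet : ∀ {n k} → Vec (StarVertex n) k → Set
IsVertexSet W = Injective _≡_ _≡_ (lookup W)

Resolving : ∀ {n k} → StarSignature n → Vec (StarVertex n) k → Set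
Resolving σ W = ∀ u v → rep σ W u ≡ rep σ W v → u ≡ v

HasDim : ∀ {n} → StarSignature n → ℕ → Set
HasDim {n} σ m =
  (Σ (Vec (StarVertex n) m) λ W → IsVertexSet W × Resolving σ W)
  × (∀ k (W : Vec (StarVertex n) k) → IsVertexSet W → Resolving σ W → m ≤ k)

NonHomogeneous : ∀ {n} → StarSignature n → Set
NonHomogeneous σ = (∃ λ i → σ i ≡ +) × (∃ λ j → σ j ≡ -)

{-# OPTIONS --safe #-}
module Submission where

-- A leaf missing from W is seen from every vertex of W only through the sign of its
-- edge, so two missing leaves of equal sign have the same representation: a resolving
-- set misses at most one leaf of each sign, whence n − 2 ≤ |W|.  Conversely, list every
-- leaf except one positive and one negative leaf.  A listed leaf is at distance 0 from
-- itself, 1 from the centre and 2 from the other leaves, and the two missing leaves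
-- reach it along paths of opposite signs, so this list of n − 2 leaves resolves.

open import Defs
open import Data.Nat using (ℕ; zero; suc; _+_; _≤_; _∸_; s≤s)
open import Data.Nat.Properties using (m≤n+o⇒m∸n≤o)
open import Data.Fin using (Fin; zero; suc; _≟_; punchIn; punchOut)
open import Data.Fin.Properties
  using (suc-injective; punchIn-injective; punchIn-punchOut; punchOut-injective; injective⇒≤)
open import Data.Integer using (0ℤ; _◃_; ∣_∣; sign)
open import Data.Integer.Properties using (abs-◃; sign-◃)
open import Data.Sign using (Sign) renaming (_*_ to _*ˢ_)
open import Data.Sign.Properties using (*-cancelʳ-≡)
open import Data.Vec using (Vec; []; _∷_; lookup; tabulate)
open import Data.Vec.Properties using (∷-injectiveˡ; ∷-injectiveʳ; lookup∘tabulate)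
open import Data.Vec.Relation.Unary.Any using (here; there; index)
open import Data.Vec.Relation.Unary.Any.Properties using (lookup-index)
open import Data.Vec.Membership.Propositional.Properties using (∈-tabulate⁺)
open import Data.Product using (∃; _,_)
open import Data.Sum using (_⊎_; inj₁; inj₂)
open import Data.Sum.Properties using (inj₁-injective; inj₂-injective)
open import Function using (_∘_)
open import Function.Definitions using (Injective)
open import Relation.Binary.PropositionalEquality
open import Relation.Nullary using (yes; no; contradiction)

module _ {n : ℕ} where
  open import Data.Vec.Membership.DecPropositional (_≟_ {suc n}) public
    using (_∈_; _∉_; _∈?_)

dist≡0⇒≡ : ∀ {n} {u v : StarVertex n} → dist u v ≡ 0 → u ≡ v
dist≡0⇒≡ {u = zero}  {zero}  _ = refl
dist≡0⇒≡ {u = suc i} {suc j} d≡0 with i ≟ j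
... | yes i≡j = cong suc i≡j
dist≡0⇒≡ {u = suc i} {suc j} () | no _

dist-leaves≢1 : ∀ {n} (i j : Fin n) → dist (suc i) (suc j) ≢ 1
dist-leaves≢1 i j with i ≟ j
... | yes _ = λ ()
... | no  _ = λ ()

fromSign⊎Fin : ∀ {k} → Sign ⊎ Fin k → Fin (2 + k)
fromSign⊎Fin (inj₁ Sign.+) = zero
fromSign⊎Fin (inj₁ Sign.-) = suc zero
fromSign⊎Fin (inj₂ p) = suc (suc p)

fromSign⊎Fin-injective : ∀ {k} → Injective _≡_ _≡_ (fromSign⊎Fin {k})
fromSign⊎Fin-injective {x = inj₁ Sign.+ } {inj₁ Sign.+ } _  = refl
fromSign⊎Fin-injective {x = inj₁ Sign.- } {inj₁ Sign.- } _  = refl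
fromSign⊎Fin-injective {x = inj₂ p}       {inj₂ q}       eq = cong inj₂ (suc-injective (suc-injective eq))
fromSign⊎Fin-injective {x = inj₁ Sign.+ } {inj₁ Sign.- } ()
fromSign⊎Fin-injective {x = inj₁ Sign.- } {inj₁ Sign.+ } ()
fromSign⊎Fin-injective {x = inj₁ Sign.+ } {inj₂ _}       ()
fromSign⊎Fin-injective {x = inj₁ Sign.- } {inj₂ _}       ()
fromSign⊎Fin-injective {x = inj₂ _}       {inj₁ Sign.+ } ()
fromSign⊎Fin-injective {x = inj₂ _}       {inj₁ Sign.- } ()

module _ {n : ℕ} (σ : StarSignature n) where

  signedDist-self : ∀ u → signedDist σ u u ≡ 0ℤ
  signedDist-self zero = refl
  signedDist-self (suc i) with i ≟ i
  ... | yes _   = refl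
  ... | no  i≢i = contradiction refl i≢i

  signedDist≡0⇒≡ : ∀ {u v} → signedDist σ u v ≡ 0ℤ → u ≡ v
  signedDist≡0⇒≡ {u} {v} eq = dist≡0⇒≡ (trans (sym (abs-◃ (pathSign σ u v) (dist u v))) (cong ∣_∣ eq))

  signedDist-distinctLeaves : ∀ {i j} → i ≢ j → signedDist σ (suc i) (suc j) ≡ (σ i *ˢ σ j) ◃ 2
  signedDist-distinctLeaves {i} {j} i≢j with i ≟ j
  ... | yes i≡j = contradiction i≡j i≢j
  ... | no  _   = refl

  signedDist-leaf-cong : ∀ {i j w} → σ i ≡ σ j → suc i ≢ w → suc j ≢ w →
                         signedDist σ (suc i) w ≡ signedDist σ (suc j) w
  signedDist-leaf-cong {w = zero} σi≡σj _ _ = cong (_◃ 1) σi≡σj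
  signedDist-leaf-cong {i} {j} {suc l} σi≡σj i≢w j≢w = begin
    signedDist σ (suc i) (suc l) ≡⟨ signedDist-distinctLeaves (i≢w ∘ cong suc) ⟩
    (σ i *ˢ σ l) ◃ 2             ≡⟨ cong (λ s → (s *ˢ σ l) ◃ 2) σi≡σj ⟩
    (σ j *ˢ σ l) ◃ 2             ≡⟨ signedDist-distinctLeaves (j≢w ∘ cong suc) ⟨
    signedDist σ (suc j) (suc l) ∎
    where open ≡-Reasoning

  signedDist-≡⇒dist-≡ : ∀ u v {w} → signedDist σ u w ≡ signedDist σ v w → dist u w ≡ dist v w
  signedDist-≡⇒dist-≡ u v {w} eq = begin
    dist u w                   ≡⟨ abs-◃ (pathSign σ u w) (dist u w) ⟨
    ∣ signedDist σ u w ∣       ≡⟨ cong ∣_∣ eq ⟩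
    ∣ signedDist σ v w ∣       ≡⟨ abs-◃ (pathSign σ v w) (dist v w) ⟩
    dist v w                   ∎
    where open ≡-Reasoning

  rep-leaf-cong : ∀ {k} (W : Vec (StarVertex n) k) {i j} → σ i ≡ σ j →
                  suc i ∉ W → suc j ∉ W → rep σ W (suc i) ≡ rep σ W (suc j)
  rep-leaf-cong []      _     _   _   = refl
  rep-leaf-cong (w ∷ W) σi≡σj i∉W j∉W =
    cong₂ _∷_ (signedDist-leaf-cong σi≡σj (i∉W ∘ here) (j∉W ∘ here))
              (rep-leaf-cong W σi≡σj (i∉W ∘ there) (j∉W ∘ there))

  rep-≡⇒signedDist-≡ : ∀ {k} {W : Vec (StarVertex n) k} u v {w} → w ∈ W →
                       rep σ W u ≡ rep σ W v → signedDist σ u w ≡ signedDist σ v w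
  rep-≡⇒signedDist-≡ u v (here refl)  eq = ∷-injectiveˡ eq
  rep-≡⇒signedDist-≡ u v (there w∈W) eq = rep-≡⇒signedDist-≡ u v w∈W (∷-injectiveʳ eq)

  rep-≡⇒≡-∈ : ∀ {k} {W : Vec (StarVertex n) k} {u v} → u ∈ W → rep σ W u ≡ rep σ W v → u ≡ v
  rep-≡⇒≡-∈ {u = u} {v} u∈W eq =
    sym (signedDist≡0⇒≡ (trans (sym (rep-≡⇒signedDist-≡ u v u∈W eq)) (signedDist-self u)))

  SignsSeparateLeavesOff : ∀ {k} → Vec (StarVertex n) k → Set
  SignsSeparateLeavesOff W = ∀ {i j} → suc i ∉ W → suc j ∉ W → σ i ≡ σ j → i ≡ j

  resolving⇒signsSeparate : ∀ {k} {W : Vec (StarVertex n) k} → Resolving σ W → SignsSeparateLeavesOff W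
  resolving⇒signsSeparate res i∉W j∉W σi≡σj = suc-injective (res _ _ (rep-leaf-cong _ σi≡σj i∉W j∉W))

  signsSeparate⇒≡-∉ : ∀ {k} {W : Vec (StarVertex n) k} {l} → suc l ∈ W → SignsSeparateLeavesOff W →
                      ∀ {u v} → u ∉ W → v ∉ W → signedDist σ u (suc l) ≡ signedDist σ v (suc l) → u ≡ v
  signsSeparate⇒≡-∉ _ _ {zero}  {zero}  _ _ _  = refl
  signsSeparate⇒≡-∉ {l = l} _ _ {zero} {suc j} _ _ eq =
    contradiction (sym (signedDist-≡⇒dist-≡ zero (suc j) eq)) (dist-leaves≢1 j l)
  signsSeparate⇒≡-∉ {l = l} _ _ {suc i} {zero} _ _ eq =
    contradiction (signedDist-≡⇒dist-≡ (suc i) zero eq) (dist-leaves≢1 i l)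
  signsSeparate⇒≡-∉ {l = l} l∈W separate {suc i} {suc j} i∉W j∉W eq =
    cong suc (separate i∉W j∉W (*-cancelʳ-≡ (σ l) (σ i) (σ j) signs-≡))
    where
    signs-≡ : σ i *ˢ σ l ≡ σ j *ˢ σ l
    signs-≡ = begin
      σ i *ˢ σ l                            ≡⟨ sign-◃ (σ i *ˢ σ l) 2 ⟨
      sign ((σ i *ˢ σ l) ◃ 2)               ≡⟨ cong sign (signedDist-distinctLeaves λ { refl → i∉W l∈W }) ⟨
      sign (signedDist σ (suc i) (suc l))   ≡⟨ cong sign eq ⟩
      sign (signedDist σ (suc j) (suc l))   ≡⟨ cong sign (signedDist-distinctLeaves λ { refl → j∉W l∈W }) ⟩
      sign ((σ j *ˢ σ l) ◃ 2)               ≡⟨ sign-◃ (σ j *ˢ σ l) 2 ⟩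
      σ j *ˢ σ l                            ∎
      where open ≡-Reasoning

  signsSeparate⇒resolving : ∀ {k} {W : Vec (StarVertex n) k} {l} → suc l ∈ W →
                            SignsSeparateLeavesOff W → Resolving σ W
  signsSeparate⇒resolving {W = W} l∈W separate u v eq with u ∈? W | v ∈? W
  ... | yes u∈W | _       = rep-≡⇒≡-∈ u∈W eq
  ... | no  _   | yes v∈W = sym (rep-≡⇒≡-∈ v∈W (sym eq))
  ... | no  u∉W | no  v∉W = signsSeparate⇒≡-∉ l∈W separate u∉W v∉W (rep-≡⇒signedDist-≡ u v l∈W eq)

  leafLabel : ∀ {k} → Vec (StarVertex n) k → Fin n → Sign ⊎ Fin k
  leafLabel W i with suc i ∈? W
  ... | yes i∈W = inj₂ (index i∈W)
  ... | no  _   = inj₁ (σ i)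

  leafLabel-injective : ∀ {k} {W : Vec (StarVertex n) k} → SignsSeparateLeavesOff W →
                        Injective _≡_ _≡_ (leafLabel W)
  leafLabel-injective {W = W} separate {i} {j} eq with suc i ∈? W | suc j ∈? W
  ... | yes i∈W | yes j∈W = suc-injective (begin
    suc i                ≡⟨ lookup-index i∈W ⟩
    lookup W (index i∈W) ≡⟨ cong (lookup W) (inj₂-injective eq) ⟩
    lookup W (index j∈W) ≡⟨ lookup-index j∈W ⟨
    suc j                ∎)
    where open ≡-Reasoning
  ... | no  i∉W | no  j∉W = separate i∉W j∉W (inj₁-injective eq)

  signsSeparate⇒≤2+k : ∀ {k} {W : Vec (StarVertex n) k} → SignsSeparateLeavesOff W → n ≤ 2 + k
  signsSeparate⇒≤2+k separate = injective⇒≤ (leafLabel-injective separate ∘ fromSign⊎Fin-injective)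

module _ {m : ℕ} {i₀ j₀ : Fin (2 + m)} (i₀≢j₀ : i₀ ≢ j₀) where

  skipBoth : Fin m → Fin (2 + m)
  skipBoth p = punchIn i₀ (punchIn (punchOut i₀≢j₀) p)

  skipBoth-injective : Injective _≡_ _≡_ skipBoth
  skipBoth-injective eq = punchIn-injective _ _ _ (punchIn-injective i₀ _ _ eq)

  skipBoth-hits : ∀ {l} → l ≢ i₀ → l ≢ j₀ → ∃ λ p → skipBoth p ≡ l
  skipBoth-hits {l} l≢i₀ l≢j₀ = punchOut j₀′≢l′ , (begin
    punchIn i₀ (punchIn j₀′ (punchOut j₀′≢l′)) ≡⟨ cong (punchIn i₀) (punchIn-punchOut j₀′≢l′) ⟩
    punchIn i₀ l′                              ≡⟨ punchIn-punchOut i₀≢l ⟩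
    l                                          ∎)
    where
    open ≡-Reasoning
    i₀≢l : i₀ ≢ l
    i₀≢l = l≢i₀ ∘ sym
    j₀′ l′ : Fin (suc m)
    j₀′ = punchOut i₀≢j₀
    l′  = punchOut i₀≢l
    j₀′≢l′ : j₀′ ≢ l′
    j₀′≢l′ = l≢j₀ ∘ sym ∘ punchOut-injective i₀≢j₀ i₀≢l

  leavesExcept : Vec (StarVertex (2 + m)) m
  leavesExcept = tabulate (suc ∘ skipBoth)

  leavesExcept-isVertexSet : IsVertexSet leavesExcept
  leavesExcept-isVertexSet {p} {q} eq = skipBoth-injective (suc-injective (begin
    suc (skipBoth p)      ≡⟨ lookup∘tabulate (suc ∘ skipBoth) p ⟨
    lookup leavesExcept p ≡⟨ eq ⟩
    lookup leavesExcept q ≡⟨ lookup∘tabulate (suc ∘ skipBoth) q ⟩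
    suc (skipBoth q)      ∎))
    where open ≡-Reasoning

  ∉-leavesExcept : ∀ {l} → suc l ∉ leavesExcept → l ≡ i₀ ⊎ l ≡ j₀
  ∉-leavesExcept {l} l∉W with l ≟ i₀ | l ≟ j₀
  ... | yes l≡i₀ | _        = inj₁ l≡i₀
  ... | no  _    | yes l≡j₀ = inj₂ l≡j₀
  ... | no  l≢i₀ | no  l≢j₀ with skipBoth-hits l≢i₀ l≢j₀
  ...   | p , refl = contradiction (∈-tabulate⁺ (suc ∘ skipBoth) p) l∉W

  leavesExcept-signsSeparate : (σ : StarSignature (2 + m)) → σ i₀ ≢ σ j₀ →
                               SignsSeparateLeavesOff σ leavesExcept
  leavesExcept-signsSeparate σ σi₀≢σj₀ {i} {j} i∉W j∉W σi≡σj
    with ∉-leavesExcept i∉W | ∉-leavesExcept j∉W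
  ... | inj₁ refl | inj₁ refl = refl
  ... | inj₂ refl | inj₂ refl = refl
  ... | inj₁ refl | inj₂ refl = contradiction σi≡σj σi₀≢σj₀
  ... | inj₂ refl | inj₁ refl = contradiction (sym σi≡σj) σi₀≢σj₀

theorem2p10 : (n : ℕ) → 3 ≤ n → (σ : StarSignature n) →
    NonHomogeneous σ → HasDim σ (n ∸ 2)
theorem2p10 (suc (suc (suc k))) _ σ ((i₀ , σi₀≡+) , (j₀ , σj₀≡-)) =
  ( leavesExcept i₀≢j₀
  , leavesExcept-isVertexSet i₀≢j₀
  , signsSeparate⇒resolving σ (∈-tabulate⁺ (suc ∘ skipBoth i₀≢j₀) zero) (leavesExcept-signsSeparate i₀≢j₀ σ σi₀≢σj₀))
  , λ _ W _ resolving → m≤n+o⇒m∸n≤o _ 2 (signsSeparate⇒≤2+k σ (resolving⇒signsSeparate σ resolving))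
  where
  σi₀≢σj₀ : σ i₀ ≢ σ j₀
  σi₀≢σj₀ eq with trans (sym σi₀≡+) (trans eq σj₀≡-)
  ... | ()
  i₀≢j₀ : i₀ ≢ j₀
  i₀≢j₀ = σi₀≢σj₀ ∘ cong σ
theorem2p10 0               () _
theorem2p10 1               (s≤s ()) _
theorem2p10 2               (s≤s (s≤s ())) _
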